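{- Let $A$ be an LM$_\theta$-algebra. Any two Boolean congruences $\varphi_1,\varphi_2$ of $A$ permute, i.e. $\varphi_1\circ\varphi_2=\varphi_2\circ\varphi_1$.
   Context: Let $\theta\ge 2$ be the order type of a totally ordered set $J$ with least element $0$, $J=\{0\}+I$ (ordinal sum). An LM$_\theta$-algebra is an algebra $\langle A,\vee,\wedge,0,1,\{\phi_i\}_{i\in I},\{\overline{\phi}_i\}_{i\in I}\rangle$ with $\langle A,\vee,\wedge,0,1\rangle$ a bounded distributive lattice such that for all $i,j\in I$, $x,y\in A$: $\phi_i$ is a bounded lattice endomorphism; $\phi_i x\vee\overline{\phi}_i x=1$, $\phi_i x\wedge\overline{\phi}_i x=0$; $\phi_i\phi_j x=\phi_j x$; $i\le j$ implies $\phi_i x\le\phi_j x$; $\phi_i x=\phi_i y$ for all $i$ implies $x=y$. A Boolean congruence is a congruence having a complement in the lattice of all congruences of $A$. $\circ$ denotes relational composition. -}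

module Defs where

open import Data.Product using (Σ; _×_; ∃-syntax; _,_)
open import Relation.Binary.PropositionalEquality using (_≡_)
open import Relation.Binary.Structures using (IsTotalOrder)
open import Relation.Binary.Core using (Rel)
open import Relation.Binary.Structures using (IsEquivalence)
open import Algebra.Lattice.Structures using (IsDistributiveLattice)

-- An LM_θ-algebra.  J = {0} + I is totally ordered with least element 0;
-- θ ≥ 2 means I is nonempty (field `i₀`).  The carrier equality is ≡.
record LMAlgebra : Set₁ where
  infixr 6 _∨_
  infixr 7 _∧_
  field
    I      : Set
    _≤I_   : Rel I _
    ≤I-tot : IsTotalOrder _≡_ _≤I_
    i₀     : I
    A      : Set
    _∨_ _∧_ : A → A → A
    𝟘 𝟙    : A
    isDL   : IsDistributiveLattice _≡_ _∨_ _∧_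
    ∨-𝟘    : ∀ x → x ∨ 𝟘 ≡ x
    ∧-𝟙    : ∀ x → x ∧ 𝟙 ≡ x
    φ φ̄    : I → A → A
    φ-∨    : ∀ i x y → φ i (x ∨ y) ≡ φ i x ∨ φ i y
    φ-∧    : ∀ i x y → φ i (x ∧ y) ≡ φ i x ∧ φ i y
    φ-𝟘    : ∀ i → φ i 𝟘 ≡ 𝟘
    φ-𝟙    : ∀ i → φ i 𝟙 ≡ 𝟙
    φ∨φ̄    : ∀ i x → φ i x ∨ φ̄ i x ≡ 𝟙
    φ∧φ̄    : ∀ i x → φ i x ∧ φ̄ i x ≡ 𝟘
    φφ     : ∀ i j x → φ i (φ j x) ≡ φ j x
    φ-mono : ∀ i j x → i ≤I j → φ i x ∨ φ j x ≡ φ j x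
    φ-det  : ∀ x y → (∀ i → φ i x ≡ φ i y) → x ≡ y

module _ (L : LMAlgebra) where
  open LMAlgebra L

  record IsCongruence (θ : A → A → Set) : Set where
    field
      isEquiv : IsEquivalence θ
      cong-∨  : ∀ {x y u v} → θ x y → θ u v → θ (x ∨ u) (y ∨ v)
      cong-∧  : ∀ {x y u v} → θ x y → θ u v → θ (x ∧ u) (y ∧ v)
      cong-φ  : ∀ i {x y} → θ x y → θ (φ i x) (φ i y)
      cong-φ̄  : ∀ i {x y} → θ x y → θ (φ̄ i x) (φ̄ i y)

  Congruence : Set₁
  Congruence = Σ (A → A → Set) IsCongruence

  -- a congruence ψ is a complement of θ in the congruence lattice Con(A):
  -- θ ∧ ψ = Δ (meet is intersection) and θ ∨ ψ = ∇ (the least congruence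
  -- containing both is the total relation)
  IsComplementOf : (θ ψ : A → A → Set) → Set₁
  IsComplementOf θ ψ =
    (∀ x y → θ x y → ψ x y → x ≡ y) ×
    (∀ (χ : Congruence) → (let open Σ χ renaming (proj₁ to R) in
       (∀ x y → θ x y → R x y) → (∀ x y → ψ x y → R x y) → ∀ x y → R x y))

  IsBooleanCongruence : (θ : A → A → Set) → Set₁
  IsBooleanCongruence θ = IsCongruence θ × ∃[ ψ ] (IsCongruence ψ × IsComplementOf θ ψ)

  _∘ʳ_ : (θ ψ : A → A → Set) → A → A → Set
  (θ ∘ʳ ψ) x y = ∃[ z ] (θ x z × ψ z y)

module Submission where

-- A Boolean congruence θ with complement ψ is the kernel of x ↦ x ∧ a for a complemented
-- element a.  Indeed, "for every i, φᵢ x and φᵢ y agree below some a ∧ b with a θ 1 and b ψ 1"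
-- is a congruence; it contains θ and ψ, since x θ y gives (φᵢx ∧ φᵢy) ∨ (φ̄ᵢx ∧ φ̄ᵢy) θ 1
-- (and likewise for ψ).  Hence it relates 1 and 0, which yields such a and b with a ∧ b = 0;
-- then a ∨ b = 1 because θ ∩ ψ = Δ, and x θ y iff x ∧ a = y ∧ a.  Finally, two such kernels
-- permute: if x ∧ e₁ = z ∧ e₁ and z ∧ e₂ = y ∧ e₂, then w = (x ∧ e₂) ∨ (y ∧ e₁) satisfies
-- x ∧ e₂ = w ∧ e₂ and w ∧ e₁ = y ∧ e₁.

open import Defs
open import Algebra.Core using (Op₂)
open import Algebra.Lattice.Bundles using (DistributiveLattice)
open import Algebra.Lattice.Structures using (IsDistributiveLattice)
open import Algebra.Bundles using (CommutativeSemigroup)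
import Algebra.Lattice.Properties.Lattice as LatticeProperties
import Algebra.Properties.CommutativeSemigroup as CommutativeSemigroupProperties
open import Data.Product using (_×_; _,_; ∃-syntax; proj₁; proj₂)
open import Function.Bundles using (_⇔_; mk⇔; Equivalence)
open import Relation.Binary.PropositionalEquality
open import Relation.Binary.Structures using (IsEquivalence)

record BoundedDistributiveLattice : Set₁ where
  infixr 6 _∨_
  infixr 7 _∧_
  field
    Carrier               : Set
    _∨_ _∧_               : Op₂ Carrier
    𝟘 𝟙                   : Carrier
    isDistributiveLattice : IsDistributiveLattice _≡_ _∨_ _∧_
    ∨-identityʳ           : ∀ x → x ∨ 𝟘 ≡ x
    ∧-identityʳ           : ∀ x → x ∧ 𝟙 ≡ x

module BoundedDistributiveLatticeProperties (D : BoundedDistributiveLattice) where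
  open BoundedDistributiveLattice D
  open IsDistributiveLattice isDistributiveLattice
    using (∨-comm; ∧-comm; ∧-assoc; ∨-absorbs-∧; ∧-absorbs-∨; ∧-distribˡ-∨; ∧-distribʳ-∨)
  open ≡-Reasoning

  private
    distributiveLattice : DistributiveLattice _ _
    distributiveLattice = record { isDistributiveLattice = isDistributiveLattice }

  open LatticeProperties (DistributiveLattice.lattice distributiveLattice)
    using (∧-isSemigroup)
  open LatticeProperties (DistributiveLattice.lattice distributiveLattice) public
    using (∧-idem)

  private
    ∧-commutativeSemigroup : CommutativeSemigroup _ _
    ∧-commutativeSemigroup = record
      { isCommutativeSemigroup = record
        { isSemigroup = ∧-isSemigroup ; comm = ∧-comm } }

  open CommutativeSemigroupProperties ∧-commutativeSemigroup public
    renaming (interchange to ∧-interchange)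
    using ()

  ∨-identityˡ : ∀ x → 𝟘 ∨ x ≡ x
  ∨-identityˡ x = trans (∨-comm 𝟘 x) (∨-identityʳ x)

  ∧-identityˡ : ∀ x → 𝟙 ∧ x ≡ x
  ∧-identityˡ x = trans (∧-comm 𝟙 x) (∧-identityʳ x)

  ∧-zeroˡ : ∀ x → 𝟘 ∧ x ≡ 𝟘
  ∧-zeroˡ x = trans (cong (𝟘 ∧_) (sym (∨-identityˡ x))) (∧-absorbs-∨ 𝟘 x)

  ∧-zeroʳ : ∀ x → x ∧ 𝟘 ≡ 𝟘
  ∧-zeroʳ x = trans (∧-comm x 𝟘) (∧-zeroˡ x)

  ∨-zeroˡ : ∀ x → 𝟙 ∨ x ≡ 𝟙
  ∨-zeroˡ x = trans (cong (𝟙 ∨_) (sym (∧-identityˡ x))) (∨-absorbs-∧ 𝟙 x)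

  ∨-zeroʳ : ∀ x → x ∨ 𝟙 ≡ 𝟙
  ∨-zeroʳ x = trans (∨-comm x 𝟙) (∨-zeroˡ x)

  IsComplement : Carrier → Carrier → Set
  IsComplement p q = p ∨ q ≡ 𝟙 × p ∧ q ≡ 𝟘

  complement-unique : ∀ {p q q'} → IsComplement p q → IsComplement p q' → q ≡ q'
  complement-unique {p} {q} {q'} (q₁ , q₀) (q'₁ , q'₀) = begin
    q       ≡⟨ below q'₁ q₀ ⟩
    q ∧ q'  ≡⟨ ∧-comm q q' ⟩
    q' ∧ q  ≡⟨ sym (below q₁ q'₀) ⟩
    q'      ∎
    where
    below : ∀ {r s} → p ∨ s ≡ 𝟙 → p ∧ r ≡ 𝟘 → r ≡ r ∧ s
    below {r} {s} p∨s p∧r = begin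
      r                  ≡⟨ sym (∧-identityʳ r) ⟩
      r ∧ 𝟙              ≡⟨ cong (r ∧_) (sym p∨s) ⟩
      r ∧ (p ∨ s)        ≡⟨ ∧-distribˡ-∨ r p s ⟩
      r ∧ p ∨ r ∧ s      ≡⟨ cong (_∨ r ∧ s) (trans (∧-comm r p) p∧r) ⟩
      𝟘 ∨ r ∧ s          ≡⟨ ∨-identityˡ (r ∧ s) ⟩
      r ∧ s              ∎

  ∧-distribʳ-∧ : ∀ c x y → (x ∧ y) ∧ c ≡ (x ∧ c) ∧ (y ∧ c)
  ∧-distribʳ-∧ c x y = begin
    (x ∧ y) ∧ c        ≡⟨ cong ((x ∧ y) ∧_) (sym (∧-idem c)) ⟩
    (x ∧ y) ∧ (c ∧ c)  ≡⟨ ∧-interchange x y c c ⟩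
    (x ∧ c) ∧ (y ∧ c)  ∎

  AgreeBelow : Carrier → Carrier → Carrier → Set
  AgreeBelow c x y = x ∧ c ≡ y ∧ c

  agreeBelow-∧ʳ : ∀ {c} d {x y} → AgreeBelow c x y → AgreeBelow (c ∧ d) x y
  agreeBelow-∧ʳ {c} d {x} {y} x~y = begin
    x ∧ (c ∧ d)  ≡⟨ sym (∧-assoc x c d) ⟩
    (x ∧ c) ∧ d  ≡⟨ cong (_∧ d) x~y ⟩
    (y ∧ c) ∧ d  ≡⟨ ∧-assoc y c d ⟩
    y ∧ (c ∧ d)  ∎

  agreeBelow-∧ˡ : ∀ c {d x y} → AgreeBelow d x y → AgreeBelow (c ∧ d) x y
  agreeBelow-∧ˡ c {d} x~y = subst (λ e → AgreeBelow e _ _) (∧-comm d c) (agreeBelow-∧ʳ c x~y)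

  agreeBelow-∨ : ∀ {c x y u v} → AgreeBelow c x y → AgreeBelow c u v → AgreeBelow c (x ∨ u) (y ∨ v)
  agreeBelow-∨ {c} {x} {y} {u} {v} x~y u~v = begin
    (x ∨ u) ∧ c        ≡⟨ ∧-distribʳ-∨ c x u ⟩
    x ∧ c ∨ u ∧ c      ≡⟨ cong₂ _∨_ x~y u~v ⟩
    y ∧ c ∨ v ∧ c      ≡⟨ sym (∧-distribʳ-∨ c y v) ⟩
    (y ∨ v) ∧ c        ∎

  agreeBelow-∧ : ∀ {c x y u v} → AgreeBelow c x y → AgreeBelow c u v → AgreeBelow c (x ∧ u) (y ∧ v)
  agreeBelow-∧ {c} {x} {y} {u} {v} x~y u~v = begin
    (x ∧ u) ∧ c        ≡⟨ ∧-distribʳ-∧ c x u ⟩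
    (x ∧ c) ∧ (u ∧ c)  ≡⟨ cong₂ _∧_ x~y u~v ⟩
    (y ∧ c) ∧ (v ∧ c)  ≡⟨ sym (∧-distribʳ-∧ c y v) ⟩
    (y ∧ v) ∧ c        ∎

  agreeBelow-complement : ∀ {c p p̄ r r̄} → IsComplement p p̄ → IsComplement r r̄ →
                          AgreeBelow c p r → AgreeBelow c p̄ r̄
  agreeBelow-complement {c} {p} {p̄} {r} {r̄} (p∨p̄ , p∧p̄) (r∨r̄ , r∧r̄) p~r = begin
    p̄ ∧ c          ≡⟨ below p∧p̄ r∨r̄ p~r ⟩
    (p̄ ∧ r̄) ∧ c    ≡⟨ cong (_∧ c) (∧-comm p̄ r̄) ⟩
    (r̄ ∧ p̄) ∧ c    ≡⟨ sym (below r∧r̄ p∨p̄ (sym p~r)) ⟩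
    r̄ ∧ c          ∎
    where
    below : ∀ {p p̄ r r̄} → p ∧ p̄ ≡ 𝟘 → r ∨ r̄ ≡ 𝟙 → AgreeBelow c p r → p̄ ∧ c ≡ (p̄ ∧ r̄) ∧ c
    below {p} {p̄} {r} {r̄} p∧p̄ r∨r̄ p~r = begin
      p̄ ∧ c                        ≡⟨ cong (_∧ c) (sym (trans (cong (p̄ ∧_) r∨r̄) (∧-identityʳ p̄))) ⟩
      (p̄ ∧ (r ∨ r̄)) ∧ c            ≡⟨ cong (_∧ c) (∧-distribˡ-∨ p̄ r r̄) ⟩
      (p̄ ∧ r ∨ p̄ ∧ r̄) ∧ c          ≡⟨ ∧-distribʳ-∨ c (p̄ ∧ r) (p̄ ∧ r̄) ⟩
      (p̄ ∧ r) ∧ c ∨ (p̄ ∧ r̄) ∧ c    ≡⟨ cong (_∨ (p̄ ∧ r̄) ∧ c) p̄∧r∧c ⟩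
      𝟘 ∨ (p̄ ∧ r̄) ∧ c              ≡⟨ ∨-identityˡ _ ⟩
      (p̄ ∧ r̄) ∧ c                  ∎
      where
      p̄∧r∧c : (p̄ ∧ r) ∧ c ≡ 𝟘
      p̄∧r∧c = begin
        (p̄ ∧ r) ∧ c  ≡⟨ ∧-assoc p̄ r c ⟩
        p̄ ∧ (r ∧ c)  ≡⟨ cong (p̄ ∧_) (sym p~r) ⟩
        p̄ ∧ (p ∧ c)  ≡⟨ sym (∧-assoc p̄ p c) ⟩
        (p̄ ∧ p) ∧ c  ≡⟨ cong (_∧ c) (trans (∧-comm p̄ p) p∧p̄) ⟩
        𝟘 ∧ c        ≡⟨ ∧-zeroˡ c ⟩
        𝟘            ∎

  agreeBelow-biconditional : ∀ {p p̄ r r̄} → p ∧ p̄ ≡ 𝟘 → r ∧ r̄ ≡ 𝟘 →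
                             AgreeBelow (p ∧ r ∨ p̄ ∧ r̄) p r
  agreeBelow-biconditional {p} {p̄} {r} {r̄} p∧p̄ r∧r̄ = begin
    p ∧ (p ∧ r ∨ p̄ ∧ r̄)  ≡⟨ meet p∧p̄ ⟩
    p ∧ r                ≡⟨ ∧-comm p r ⟩
    r ∧ p                ≡⟨ sym (meet r∧r̄) ⟩
    r ∧ (r ∧ p ∨ r̄ ∧ p̄)  ≡⟨ cong (r ∧_) (cong₂ _∨_ (∧-comm r p) (∧-comm r̄ p̄)) ⟩
    r ∧ (p ∧ r ∨ p̄ ∧ r̄)  ∎
    where
    meet : ∀ {p p̄ q q̄} → p ∧ p̄ ≡ 𝟘 → p ∧ (p ∧ q ∨ p̄ ∧ q̄) ≡ p ∧ q
    meet {p} {p̄} {q} {q̄} p∧p̄ = begin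
      p ∧ (p ∧ q ∨ p̄ ∧ q̄)          ≡⟨ ∧-distribˡ-∨ p (p ∧ q) (p̄ ∧ q̄) ⟩
      p ∧ (p ∧ q) ∨ p ∧ (p̄ ∧ q̄)    ≡⟨ cong₂ _∨_ (sym (∧-assoc p p q)) (sym (∧-assoc p p̄ q̄)) ⟩
      (p ∧ p) ∧ q ∨ (p ∧ p̄) ∧ q̄    ≡⟨ cong₂ (λ s t → s ∧ q ∨ t ∧ q̄) (∧-idem p) p∧p̄ ⟩
      p ∧ q ∨ 𝟘 ∧ q̄                ≡⟨ cong (p ∧ q ∨_) (∧-zeroˡ q̄) ⟩
      p ∧ q ∨ 𝟘                    ≡⟨ ∨-identityʳ (p ∧ q) ⟩
      p ∧ q                        ∎

  agreeBelow-permute : ∀ {e₁ e₂ x y z} → AgreeBelow e₁ x z → AgreeBelow e₂ z y →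
                       ∃[ w ] AgreeBelow e₂ x w × AgreeBelow e₁ w y
  agreeBelow-permute {e₁} {e₂} {x} {y} x~z z~y = x ∧ e₂ ∨ y ∧ e₁ , sym w∧e₂ , w∧e₁
    where
    x~y : AgreeBelow (e₁ ∧ e₂) x y
    x~y = trans (agreeBelow-∧ʳ e₂ x~z) (agreeBelow-∧ˡ e₁ z~y)

    w∧e₂ : (x ∧ e₂ ∨ y ∧ e₁) ∧ e₂ ≡ x ∧ e₂
    w∧e₂ = begin
      (x ∧ e₂ ∨ y ∧ e₁) ∧ e₂          ≡⟨ ∧-distribʳ-∨ e₂ (x ∧ e₂) (y ∧ e₁) ⟩
      (x ∧ e₂) ∧ e₂ ∨ (y ∧ e₁) ∧ e₂   ≡⟨ cong₂ _∨_ (trans (∧-assoc x e₂ e₂) (cong (x ∧_) (∧-idem e₂)))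
                                                   (trans (∧-assoc y e₁ e₂) (sym x~y)) ⟩
      x ∧ e₂ ∨ x ∧ (e₁ ∧ e₂)          ≡⟨ cong (x ∧ e₂ ∨_) (trans (cong (x ∧_) (∧-comm e₁ e₂)) (sym (∧-assoc x e₂ e₁))) ⟩
      x ∧ e₂ ∨ (x ∧ e₂) ∧ e₁          ≡⟨ ∨-absorbs-∧ (x ∧ e₂) e₁ ⟩
      x ∧ e₂                          ∎

    w∧e₁ : (x ∧ e₂ ∨ y ∧ e₁) ∧ e₁ ≡ y ∧ e₁
    w∧e₁ = begin
      (x ∧ e₂ ∨ y ∧ e₁) ∧ e₁          ≡⟨ ∧-distribʳ-∨ e₁ (x ∧ e₂) (y ∧ e₁) ⟩
      (x ∧ e₂) ∧ e₁ ∨ (y ∧ e₁) ∧ e₁   ≡⟨ cong₂ _∨_ (trans (∧-assoc x e₂ e₁) (cong (x ∧_) (∧-comm e₂ e₁)))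
                                                   (trans (∧-assoc y e₁ e₁) (cong (y ∧_) (∧-idem e₁))) ⟩
      x ∧ (e₁ ∧ e₂) ∨ y ∧ e₁          ≡⟨ cong (_∨ y ∧ e₁) (trans x~y (sym (∧-assoc y e₁ e₂))) ⟩
      (y ∧ e₁) ∧ e₂ ∨ y ∧ e₁          ≡⟨ ∨-comm ((y ∧ e₁) ∧ e₂) (y ∧ e₁) ⟩
      y ∧ e₁ ∨ (y ∧ e₁) ∧ e₂          ≡⟨ ∨-absorbs-∧ (y ∧ e₁) e₂ ⟩
      y ∧ e₁                          ∎

  AgreeBelowSome : (Carrier → Set) → Carrier → Carrier → Set
  AgreeBelowSome F x y = ∃[ c ] F c × AgreeBelow c x y

  MeetClosed : (Carrier → Set) → Set
  MeetClosed F = F 𝟙 × (∀ {c d} → F c → F d → F (c ∧ d))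

  agreeBelowSome-map : ∀ {F x y u v} → (∀ {c} → AgreeBelow c x y → AgreeBelow c u v) →
                       AgreeBelowSome F x y → AgreeBelowSome F u v
  agreeBelowSome-map f (c , c∈F , x~y) = c , c∈F , f x~y

  agreeBelowSome-zip : ∀ {F x y x' y' u v} → MeetClosed F →
                       (∀ {c} → AgreeBelow c x y → AgreeBelow c x' y' → AgreeBelow c u v) →
                       AgreeBelowSome F x y → AgreeBelowSome F x' y' → AgreeBelowSome F u v
  agreeBelowSome-zip (_ , ∧-closed) f (c , c∈F , x~y) (d , d∈F , x'~y') =
    c ∧ d , ∧-closed c∈F d∈F , f (agreeBelow-∧ʳ d x~y) (agreeBelow-∧ˡ c x'~y')

module LMAlgebraProperties (L : LMAlgebra) where
  open LMAlgebra L
  open IsDistributiveLattice isDL using (∧-comm; ∧-distribˡ-∨)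

  boundedDistributiveLattice : BoundedDistributiveLattice
  boundedDistributiveLattice = record
    { Carrier               = A
    ; _∨_                   = _∨_
    ; _∧_                   = _∧_
    ; 𝟘                     = 𝟘
    ; 𝟙                     = 𝟙
    ; isDistributiveLattice = isDL
    ; ∨-identityʳ           = ∨-𝟘
    ; ∧-identityʳ           = ∧-𝟙
    }

  open BoundedDistributiveLatticeProperties boundedDistributiveLattice

  φ-complement : ∀ i x → IsComplement (φ i x) (φ̄ i x)
  φ-complement i x = φ∨φ̄ i x , φ∧φ̄ i x

  φ-preserves-complement : ∀ i {p q} → IsComplement p q → IsComplement (φ i p) (φ i q)
  φ-preserves-complement i {p} {q} (p∨q , p∧q) =
    trans (sym (φ-∨ i p q)) (trans (cong (φ i) p∨q) (φ-𝟙 i)) ,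
    trans (sym (φ-∧ i p q)) (trans (cong (φ i) p∧q) (φ-𝟘 i))

  φφ̄ : ∀ i j x → φ i (φ̄ j x) ≡ φ̄ j x
  φφ̄ i j x = complement-unique
    (subst (λ p → IsComplement p (φ i (φ̄ j x))) (φφ i j x) (φ-preserves-complement i (φ-complement j x)))
    (φ-complement j x)

  EquivModulo : (A → Set) → A → A → Set
  EquivModulo F x y = ∀ i → AgreeBelowSome F (φ i x) (φ i y)

  equivModulo-isCongruence : ∀ {F} → MeetClosed F → IsCongruence L (EquivModulo F)
  equivModulo-isCongruence {F} closed = record
    { isEquiv = record
      { refl  = λ i → 𝟙 , proj₁ closed , refl
      ; sym   = λ x~y i → agreeBelowSome-map sym (x~y i)
      ; trans = λ x~y y~z i → agreeBelowSome-zip closed trans (x~y i) (y~z i)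
      }
    ; cong-∨ = λ {x} {y} {u} {v} x~y u~v i → subst₂ (AgreeBelowSome F) (sym (φ-∨ i x u)) (sym (φ-∨ i y v))
        (agreeBelowSome-zip closed agreeBelow-∨ (x~y i) (u~v i))
    ; cong-∧ = λ {x} {y} {u} {v} x~y u~v i → subst₂ (AgreeBelowSome F) (sym (φ-∧ i x u)) (sym (φ-∧ i y v))
        (agreeBelowSome-zip closed agreeBelow-∧ (x~y i) (u~v i))
    ; cong-φ = λ j {x} {y} x~y i → subst₂ (AgreeBelowSome F) (sym (φφ i j x)) (sym (φφ i j y)) (x~y j)
    ; cong-φ̄ = λ j {x} {y} x~y i → subst₂ (AgreeBelowSome F) (sym (φφ̄ i j x)) (sym (φφ̄ i j y))
        (agreeBelowSome-map (agreeBelow-complement (φ-complement j x) (φ-complement j y)) (x~y j))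
    }

  module CongruenceLaws {θ} (cθ : IsCongruence L θ) where
    open IsCongruence cθ public
    open IsEquivalence isEquiv public

  biconditional-related-𝟙 : ∀ {θ} → IsCongruence L θ → ∀ {p p̄ r r̄} → θ p r → θ p̄ r̄ →
                            p ∨ p̄ ≡ 𝟙 → θ (p ∧ r ∨ p̄ ∧ r̄) 𝟙
  biconditional-related-𝟙 {θ} cθ {p} {p̄} p~r p̄~r̄ p∨p̄ =
    subst (θ _) (trans (cong₂ _∨_ (∧-idem p) (∧-idem p̄)) p∨p̄)
      (Θ.cong-∨ (Θ.cong-∧ Θ.refl (Θ.sym p~r)) (Θ.cong-∧ Θ.refl (Θ.sym p̄~r̄)))
    where module Θ = CongruenceLaws cθ

  congruence⊆equivModulo : ∀ {θ F} → IsCongruence L θ → (∀ {c} → θ c 𝟙 → F c) →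
                           ∀ {x y} → θ x y → EquivModulo F x y
  congruence⊆equivModulo cθ unit⊆F {x} {y} x~y i =
    φ i x ∧ φ i y ∨ φ̄ i x ∧ φ̄ i y ,
    unit⊆F (biconditional-related-𝟙 cθ (cong-φ i x~y) (cong-φ̄ i x~y) (φ∨φ̄ i x)) ,
    agreeBelow-biconditional (φ∧φ̄ i x) (φ∧φ̄ i y)
    where open IsCongruence cθ using (cong-φ; cong-φ̄)

  -- The only use of I being inhabited (the order type of J is at least 2).
  equivModulo-𝟙-𝟘 : ∀ {F} → EquivModulo F 𝟙 𝟘 → F 𝟘
  equivModulo-𝟙-𝟘 {F} 𝟙~𝟘 with 𝟙~𝟘 i₀
  ... | c , c∈F , φ𝟙~φ𝟘 = subst F c≡𝟘 c∈F
    where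
    open ≡-Reasoning
    c≡𝟘 : c ≡ 𝟘
    c≡𝟘 = begin
      c           ≡⟨ sym (∧-identityˡ c) ⟩
      𝟙 ∧ c       ≡⟨ cong (_∧ c) (sym (φ-𝟙 i₀)) ⟩
      φ i₀ 𝟙 ∧ c  ≡⟨ φ𝟙~φ𝟘 ⟩
      φ i₀ 𝟘 ∧ c  ≡⟨ cong (_∧ c) (φ-𝟘 i₀) ⟩
      𝟘 ∧ c       ≡⟨ ∧-zeroˡ c ⟩
      𝟘           ∎

  UnitMeet : (θ ψ : A → A → Set) → A → Set
  UnitMeet θ ψ c = ∃[ a ] ∃[ b ] θ a 𝟙 × ψ b 𝟙 × a ∧ b ≡ c

  unitMeet-meetClosed : ∀ {θ ψ} → IsCongruence L θ → IsCongruence L ψ → MeetClosed (UnitMeet θ ψ)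
  unitMeet-meetClosed {θ} {ψ} cθ cψ =
    (𝟙 , 𝟙 , Θ.refl , Ψ.refl , ∧-𝟙 𝟙) ,
    λ { (a₁ , b₁ , a₁~𝟙 , b₁~𝟙 , refl) (a₂ , b₂ , a₂~𝟙 , b₂~𝟙 , refl) →
          a₁ ∧ a₂ , b₁ ∧ b₂ ,
          subst (θ _) (∧-𝟙 𝟙) (Θ.cong-∧ a₁~𝟙 a₂~𝟙) ,
          subst (ψ _) (∧-𝟙 𝟙) (Ψ.cong-∧ b₁~𝟙 b₂~𝟙) ,
          ∧-interchange a₁ a₂ b₁ b₂ }
    where
    module Θ = CongruenceLaws cθ
    module Ψ = CongruenceLaws cψ

  unitMeet-𝟘 : ∀ {θ ψ} → IsCongruence L θ → IsCongruence L ψ → IsComplementOf L θ ψ → UnitMeet θ ψ 𝟘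
  unitMeet-𝟘 {θ} {ψ} cθ cψ (_ , generates) =
    equivModulo-𝟙-𝟘 (generates join (λ _ _ → congruence⊆equivModulo cθ θ-unit)
                                    (λ _ _ → congruence⊆equivModulo cψ ψ-unit) 𝟙 𝟘)
    where
    join : Congruence L
    join = EquivModulo (UnitMeet θ ψ) , equivModulo-isCongruence (unitMeet-meetClosed cθ cψ)

    θ-unit : ∀ {c} → θ c 𝟙 → UnitMeet θ ψ c
    θ-unit {c} c~𝟙 = c , 𝟙 , c~𝟙 , CongruenceLaws.refl cψ , ∧-𝟙 c

    ψ-unit : ∀ {c} → ψ c 𝟙 → UnitMeet θ ψ c
    ψ-unit {c} c~𝟙 = 𝟙 , c , CongruenceLaws.refl cθ , c~𝟙 , ∧-identityˡ c

  unitMeet-𝟘⇒complementedUnits : ∀ {θ ψ} → IsCongruence L θ → IsCongruence L ψ →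
                                  (∀ x y → θ x y → ψ x y → x ≡ y) → UnitMeet θ ψ 𝟘 →
                                  ∃[ a ] ∃[ b ] θ a 𝟙 × ψ b 𝟙 × IsComplement a b
  unitMeet-𝟘⇒complementedUnits {θ} {ψ} cθ cψ disjoint (a , b , a~𝟙 , b~𝟙 , a∧b) =
    a , b , a~𝟙 , b~𝟙 , a∨b , a∧b
    where
    a∨b : a ∨ b ≡ 𝟙
    a∨b = disjoint _ _ (subst (θ _) (∨-zeroˡ b) (Θ.cong-∨ a~𝟙 Θ.refl))
                       (subst (ψ _) (∨-zeroʳ a) (Ψ.cong-∨ Ψ.refl b~𝟙))
      where
      module Θ = CongruenceLaws cθ
      module Ψ = CongruenceLaws cψ

  congruence⇔agreeBelow : ∀ {θ ψ a b} → IsCongruence L θ → IsCongruence L ψ →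
                          (∀ x y → θ x y → ψ x y → x ≡ y) →
                          θ a 𝟙 → ψ b 𝟙 → IsComplement a b → ∀ x y → θ x y ⇔ AgreeBelow a x y
  congruence⇔agreeBelow {θ} {ψ} {a} {b} cθ cψ disjoint a~𝟙 b~𝟙 (a∨b , a∧b) x y =
    mk⇔ (λ x~y → disjoint _ _ (Θ.cong-∧ x~y Θ.refl) (Ψ.trans (meet-a~𝟘 x) (Ψ.sym (meet-a~𝟘 y))))
        (λ x∧a≡y∧a → Θ.trans (~meet-a x) (subst (λ t → θ t y) (sym x∧a≡y∧a) (Θ.sym (~meet-a y))))
    where
    module Θ = CongruenceLaws cθ
    module Ψ = CongruenceLaws cψ

    b~𝟘 : θ b 𝟘
    b~𝟘 = subst₂ θ (∧-𝟙 b) (trans (∧-comm b a) a∧b) (Θ.cong-∧ Θ.refl (Θ.sym a~𝟙))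

    a~𝟘 : ψ a 𝟘
    a~𝟘 = subst₂ ψ (∧-𝟙 a) a∧b (Ψ.cong-∧ Ψ.refl (Ψ.sym b~𝟙))

    meet-a~𝟘 : ∀ x → ψ (x ∧ a) 𝟘
    meet-a~𝟘 x = subst (ψ _) (∧-zeroʳ x) (Ψ.cong-∧ Ψ.refl a~𝟘)

    ~meet-a : ∀ x → θ x (x ∧ a)
    ~meet-a x = subst₂ θ x∧[a∨b] (trans (cong (x ∧ a ∨_) (∧-zeroʳ x)) (∨-𝟘 (x ∧ a)))
                  (Θ.cong-∨ Θ.refl (Θ.cong-∧ Θ.refl b~𝟘))
      where
      x∧[a∨b] : x ∧ a ∨ x ∧ b ≡ x
      x∧[a∨b] = trans (sym (∧-distribˡ-∨ x a b)) (trans (cong (x ∧_) a∨b) (∧-𝟙 x))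

  booleanCongruence⇔agreeBelow : ∀ {θ} → IsBooleanCongruence L θ → ∃[ e ] ∀ x y → θ x y ⇔ AgreeBelow e x y
  booleanCongruence⇔agreeBelow (cθ , _ , cψ , complement@(disjoint , _)) =
    let a , b , a~𝟙 , b~𝟙 , a⊥b = unitMeet-𝟘⇒complementedUnits cθ cψ disjoint (unitMeet-𝟘 cθ cψ complement)
    in  a , congruence⇔agreeBelow cθ cψ disjoint a~𝟙 b~𝟙 a⊥b

  agreeBelow-∘ʳ-permute : ∀ {θ₁ θ₂ e₁ e₂} →
                          (∀ x y → θ₁ x y ⇔ AgreeBelow e₁ x y) → (∀ x y → θ₂ x y ⇔ AgreeBelow e₂ x y) →
                          ∀ {x y} → _∘ʳ_ L θ₁ θ₂ x y → _∘ʳ_ L θ₂ θ₁ x y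
  agreeBelow-∘ʳ-permute k₁ k₂ {x} {y} (z , x~₁z , z~₂y) =
    let w , x~₂w , w~₁y = agreeBelow-permute (Equivalence.to (k₁ x z) x~₁z) (Equivalence.to (k₂ z y) z~₂y)
    in  w , Equivalence.from (k₂ x w) x~₂w , Equivalence.from (k₁ w y) w~₁y

  booleanCongruences-permute : ∀ {θ₁ θ₂} → IsBooleanCongruence L θ₁ → IsBooleanCongruence L θ₂ →
                               ∀ {x y} → _∘ʳ_ L θ₁ θ₂ x y → _∘ʳ_ L θ₂ θ₁ x y
  booleanCongruences-permute b₁ b₂ =
    agreeBelow-∘ʳ-permute (proj₂ (booleanCongruence⇔agreeBelow b₁)) (proj₂ (booleanCongruence⇔agreeBelow b₂))

corollary4p14 : (L : LMAlgebra) → (φ₁ φ₂ : LMAlgebra.A L → LMAlgebra.A L → Set) →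
    IsBooleanCongruence L φ₁ → IsBooleanCongruence L φ₂ →
    ∀ x y → ((_∘ʳ_ L φ₁ φ₂ x y → _∘ʳ_ L φ₂ φ₁ x y) × (_∘ʳ_ L φ₂ φ₁ x y → _∘ʳ_ L φ₁ φ₂ x y))
corollary4p14 L φ₁ φ₂ b₁ b₂ x y = booleanCongruences-permute b₁ b₂ , booleanCongruences-permute b₂ b₁
  where open LMAlgebraProperties L
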